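{- Let $\lambda$ be a partition of $N$. Two vertices $(\tau,v)$ and $(\tau',v')$ of $G_\lambda$ lie in the same connected component of $H_\lambda$ if and only if $T(\tau,v)=T(\tau',v')$.
   Context: Partitions in French convention (rows numbered bottom to top). An RST of shape $\lambda\vdash N$ is a bijective filling with $1,\dots,N$ strictly decreasing along rows (left to right) and columns (bottom to top); $\mathrm{CT}_\tau[i]=c-r$ if $i$ is in column $c$, row $r$; $\tau_\lambda$ fills the columns left to right, each bottom to top, with $N,\dots,1$. For $v\in\mathbb{N}^N$: $v^+$ is its decreasing rearrangement; $\sigma_v$ labels positions by $1,\dots,N$ in order of decreasing entries, ties left to right; $vs_i$ swaps entries $i,i+1$; $v\Psi=[v[2],\dots,v[N],v[1]+1]$. Graph $G_\lambda$: vertices are pairs $(\tau,v)$ reachable from $(\tau_\lambda,0^N)$ plus a vertex $\varnothing$; from $(\tau,v)$: edge $\Psi$ to $(\tau,v\Psi)$; edge $s_i$ to $(\tau,vs_i)$ if $v[i]<v[i+1]$; if $v[i]=v[i+1]$ and $\mathrm{CT}_\tau[\sigma_v[i]]-\mathrm{CT}_\tau[\sigma_v[i]+1]\ge2$, edge $s_i$ to $(\tau',v)$ with $\tau'$ obtained by interchanging $\sigma_v[i],\sigma_v[i]+1$ in $\tau$; if $v[i]=v[i+1]$ and this interchange is not an RST, edge $s_i$ to $\varnothing$. $H_\lambda$ is the graph obtained from $G_\lambda$ by removing all $\Psi$-edges, the vertex $\varnothing$ and the edges into it; connected components are taken ignoring edge directions. $T(\tau,v)$ is the filling of the shape $\lambda$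 obtained by replacing each entry $i$ of $\tau$ by $v^+[i]$. -}

module Defs where

open import Data.Nat using (ℕ; zero; suc; _+_; _∸_; _≤_; _<_; _≥_; _⊓_; _≤?_; _<?_; _≟_)
open import Data.List using (List; []; _∷_; _++_; [_]; map; length; filter; take; replicate; upTo; foldr)
open import Data.Nat.ListAction using (sum)
open import Data.List.Relation.Unary.All using (All)
open import Data.List.Relation.Unary.Linked using (Linked)
open import Data.Product using (_×_; _,_; ∃-syntax)
open import Data.Bool using (if_then_else_)
open import Relation.Nullary using (does)
open import Relation.Binary.PropositionalEquality using (_≡_)
open import Relation.Binary.Construct.Closure.ReflexiveTransitive using (Star)
open import Relation.Binary.Construct.Closure.Equivalence using (EqClosure)
import Data.Integer as ℤ

-- Partitions: list of parts (row lengths, bottom row first), positive,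
-- weakly decreasing, summing to N.

IsPartition : ℕ → List ℕ → Set
IsPartition N la = All (λ k → 0 < k) la × Linked _≥_ la × sum la ≡ N

-- Fillings of a shape: list of rows, row 1 (bottom) first, each row
-- listed left to right (French convention).

Filling : Set
Filling = List (List ℕ)

data AtRow : List ℕ → ℕ → ℕ → Set where
  here  : ∀ {x xs} → AtRow (x ∷ xs) 1 x
  there : ∀ {x xs c y} → AtRow xs c y → AtRow (x ∷ xs) (suc c) y

-- At τ c r x : entry x sits in column c, row r (both 1-based) of τ
data At : Filling → ℕ → ℕ → ℕ → Set where
  here  : ∀ {row rows c y} → AtRow row c y → At (row ∷ rows) c 1 y
  there : ∀ {row rows c r y} → At rows c r y → At (row ∷ rows) c (suc r) y

-- CT_τ[a] - CT_τ[b] ≥ 2, where CT_τ[i] = c - r for i in column c, row r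
ContentGap≥2 : Filling → ℕ → ℕ → Set
ContentGap≥2 τ a b =
  ∃[ c ] ∃[ r ] ∃[ c' ] ∃[ r' ]
    (At τ c r a × At τ c' r' b ×
     ((ℤ.+ c ℤ.- ℤ.+ r) ℤ.- (ℤ.+ c' ℤ.- ℤ.+ r') ℤ.≥ ℤ.+ 2))

-- τ_λ : fill the columns left to right, each bottom to top, with N,…,1.
-- cellsBefore la c = number of cells in the first c columns.
cellsBefore : List ℕ → ℕ → ℕ
cellsBefore la c = sum (map (λ m → m ⊓ c) la)

-- row with 0-based index r and length len
tauRow : ℕ → List ℕ → ℕ → ℕ → List ℕ
tauRow N la r len = map (λ c → N ∸ cellsBefore la c ∸ r) (upTo len)

tauRows : ℕ → List ℕ → ℕ → List ℕ → Filling
tauRows N la r []         = []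
tauRows N la r (m ∷ ms)   = tauRow N la r m ∷ tauRows N la (suc r) ms

tauLambda : ℕ → List ℕ → Filling
tauLambda N la = tauRows N la 0 la

swapLbl : ℕ → ℕ → ℕ
swapLbl a x = if does (x ≟ a) then suc a else (if does (x ≟ suc a) then a else x)

swapLabels : Filling → ℕ → Filling
swapLabels τ a = map (map (swapLbl a)) τ

-- Words v ∈ ℕ^N (as lists), 1-based positions

at : List ℕ → ℕ → ℕ
at []       _             = 0
at (x ∷ xs) zero          = 0
at (x ∷ xs) (suc zero)    = x
at (x ∷ xs) (suc (suc k)) = at xs (suc k)

-- v s_i : swap entries i, i+1 (1-based)
swapAt : List ℕ → ℕ → List ℕ
swapAt []           _             = []
swapAt (x ∷ [])     _             = x ∷ []
swapAt (x ∷ y ∷ xs) zero          = x ∷ y ∷ xs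
swapAt (x ∷ y ∷ xs) (suc zero)    = y ∷ x ∷ xs
swapAt (x ∷ y ∷ xs) (suc (suc k)) = x ∷ swapAt (y ∷ xs) (suc k)

psi : List ℕ → List ℕ
psi []       = []
psi (x ∷ xs) = xs ++ [ suc x ]

insertDesc : ℕ → List ℕ → List ℕ
insertDesc x []       = x ∷ []
insertDesc x (y ∷ ys) = if does (x ≤? y) then y ∷ insertDesc x ys else x ∷ y ∷ ys

vplus : List ℕ → List ℕ
vplus = foldr insertDesc []

-- σ_v[i] : label of position i when positions are labelled 1,…,N in order
-- of decreasing entries, ties broken left to right
sigma : List ℕ → ℕ → ℕ
sigma v i = suc (length (filter (at v i <?_) v)
                 + length (filter (_≟ at v i) (take (i ∸ 1) v)))

-- The graph G_λ (the vertex ∅ and edges into it are omitted: they play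
-- no role for reachability of pairs nor for H_λ).

Vertex : Set
Vertex = Filling × List ℕ

-- the s_i-edges between pairs (these are exactly the edges of H_λ)
data SEdge : Vertex → Vertex → Set where
  sv : ∀ {τ v i} → 1 ≤ i → suc i ≤ length v →
       at v i < at v (suc i) →
       SEdge (τ , v) (τ , swapAt v i)
  sτ : ∀ {τ v i} → 1 ≤ i → suc i ≤ length v →
       at v i ≡ at v (suc i) →
       ContentGap≥2 τ (sigma v i) (suc (sigma v i)) →
       SEdge (τ , v) (swapLabels τ (sigma v i) , v)

data GEdge : Vertex → Vertex → Set where
  ψ : ∀ {τ v} → GEdge (τ , v) (τ , psi v)
  s : ∀ {x y} → SEdge x y → GEdge x y

IsVertex : ℕ → List ℕ → Vertex → Set
IsVertex N la x = Star GEdge (tauLambda N la , replicate N 0) x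

HEdge : ℕ → List ℕ → Vertex → Vertex → Set
HEdge N la x y = IsVertex N la x × IsVertex N la y × SEdge x y

SameComponent : ℕ → List ℕ → Vertex → Vertex → Set
SameComponent N la = EqClosure (HEdge N la)

Tfill : Vertex → Filling
Tfill (τ , v) = map (map (at (vplus v))) τ

module Submission where

-- (⇒) Every edge of H_λ preserves T.  An edge s_i of the first kind permutes
-- v and so keeps v⁺; one of the second kind interchanges the labels σ_v[i]
-- and σ_v[i]+1, at which v⁺ takes the common value v[i] = v[i+1].
--
-- (⇐) Every vertex (τ,v) has τ an RST and |v| = N, as this holds at
-- (τ_λ,0^N) and is kept by all edges of G_λ.  From (τ,v), edges of the first
-- kind sort v into v⁺; then edges of the second kind interchange labels as
-- long as possible, which stops since the potential Σ_k k·(N - CT(cell of k))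
-- strictly decreases.  The sink (τ*,u) reached is determined by T(τ*,u):
-- labels carrying equal values of u decrease along the reading order, so a
-- strong induction on the labels shows that two sinks with equal T coincide.
-- Two vertices with equal T are thus joined through a common sink.

open import Defs
open import Data.Nat using (ℕ)
open import Data.List using (List)
open import Data.Product using (_×_)
open import Relation.Binary.PropositionalEquality using (_≡_)

open import Data.Nat
open import Data.Nat.Properties
open import Data.List using ([]; _∷_; map; length; filter; take; upTo; applyUpTo; replicate)
open import Data.List.Properties
  using (length-map; length-upTo; map-upTo; map-cong; map-∘; length-++; length-replicate; ∷-injectiveˡ; ∷-injectiveʳ)
open import Data.Nat.ListAction using (sum)
open import Function using (_∘_; case_of_)
open import Data.Nat.Induction using (<-rec)
open import Data.List.Relation.Unary.All as All using (All; []; _∷_)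
open import Data.List.Relation.Unary.AllPairs using (AllPairs; []; _∷_)
open import Data.Bool using (if_then_else_)
open import Data.Product using (_,_; proj₁; proj₂; ∃-syntax)
open import Data.Sum using (_⊎_; inj₁; inj₂)
open import Relation.Binary.Definitions using (tri<; tri≈; tri>)
open import Data.Empty using (⊥-elim)
open import Relation.Unary using (Pred; Decidable)
open import Relation.Nullary using (Dec; yes; no; ¬_; does)
open import Relation.Nullary.Decidable using (dec-true; dec-false; _×-dec_)
open import Relation.Binary.PropositionalEquality
  using (refl; sym; trans; cong; cong₂; subst; subst₂; _≢_; module ≡-Reasoning)
open import Relation.Binary.Construct.Closure.ReflexiveTransitive using (Star; ε; _◅_; _◅◅_)
open import Relation.Binary.Construct.Closure.Symmetric using (fwd; bwd)
open import Relation.Binary.Construct.Closure.Equivalence using (symmetric)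
open import Data.List.Relation.Unary.Linked.Properties using (Linked⇒AllPairs)
open import Data.Nat.Solver using (module +-*-Solver)

indicator : ∀ {p} {P : Set p} → Dec P → ℕ
indicator (yes _) = 1
indicator (no _)  = 0

count : ∀ {p} {P : Pred ℕ p} → Decidable P → List ℕ → ℕ
count P? xs = length (filter P? xs)

count-∷ : ∀ {p} {P : Pred ℕ p} (P? : Decidable P) x xs →
  count P? (x ∷ xs) ≡ indicator (P? x) + count P? xs
count-∷ P? x xs with P? x
... | yes _ = refl
... | no _  = refl

Descending : List ℕ → Set
Descending = AllPairs _≥_

ins-≤ : ∀ {x y} ys → x ≤ y → insertDesc x (y ∷ ys) ≡ y ∷ insertDesc x ys
ins-≤ {x} {y} ys x≤y =
  cong (if_then y ∷ insertDesc x ys else x ∷ y ∷ ys) (dec-true (x ≤? y) x≤y)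

ins-> : ∀ {x y} ys → y < x → insertDesc x (y ∷ ys) ≡ x ∷ y ∷ ys
ins-> {x} {y} ys y<x =
  cong (if_then y ∷ insertDesc x ys else x ∷ y ∷ ys) (dec-false (x ≤? y) (<⇒≱ y<x))

ins-front : ∀ {x} ys → All (_≤ x) ys → insertDesc x ys ≡ x ∷ ys
ins-front []       []           = refl
ins-front (y ∷ ys) (y≤x ∷ ys≤x) with m≤n⇒m<n∨m≡n y≤x
... | inj₁ y<x  = ins-> ys y<x
... | inj₂ refl = trans (ins-≤ ys ≤-refl) (cong (y ∷_) (ins-front ys ys≤x))

ins-comm-≤ : ∀ {x y} zs → y ≤ x →
  insertDesc x (insertDesc y zs) ≡ insertDesc y (insertDesc x zs)
ins-comm-≤ {x} {y} [] y≤x with m≤n⇒m<n∨m≡n y≤x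
... | inj₁ y<x  = trans (ins-> [] y<x) (sym (ins-≤ [] y≤x))
... | inj₂ refl = refl
ins-comm-≤ {x} {y} (z ∷ zs) y≤x with x ≤? z | y ≤? z
... | yes x≤z | _ = begin
  insertDesc x (insertDesc y (z ∷ zs)) ≡⟨ cong (insertDesc x) (ins-≤ zs (≤-trans y≤x x≤z)) ⟩
  insertDesc x (z ∷ insertDesc y zs)   ≡⟨ ins-≤ _ x≤z ⟩
  z ∷ insertDesc x (insertDesc y zs)   ≡⟨ cong (z ∷_) (ins-comm-≤ zs y≤x) ⟩
  z ∷ insertDesc y (insertDesc x zs)   ≡⟨ ins-≤ _ (≤-trans y≤x x≤z) ⟨
  insertDesc y (z ∷ insertDesc x zs)   ≡⟨ cong (insertDesc y) (ins-≤ zs x≤z) ⟨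
  insertDesc y (insertDesc x (z ∷ zs)) ∎
  where open ≡-Reasoning
... | no x≰z | yes y≤z = begin
  insertDesc x (insertDesc y (z ∷ zs)) ≡⟨ cong (insertDesc x) (ins-≤ zs y≤z) ⟩
  insertDesc x (z ∷ insertDesc y zs)   ≡⟨ ins-> _ (≰⇒> x≰z) ⟩
  x ∷ z ∷ insertDesc y zs              ≡⟨ cong (x ∷_) (ins-≤ zs y≤z) ⟨
  x ∷ insertDesc y (z ∷ zs)            ≡⟨ ins-≤ _ y≤x ⟨
  insertDesc y (x ∷ z ∷ zs)            ≡⟨ cong (insertDesc y) (ins-> zs (≰⇒> x≰z)) ⟨
  insertDesc y (insertDesc x (z ∷ zs)) ∎
  where open ≡-Reasoning
... | no x≰z | no y≰z = begin
  insertDesc x (insertDesc y (z ∷ zs)) ≡⟨ cong (insertDesc x) (ins-> zs (≰⇒> y≰z)) ⟩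
  insertDesc x (y ∷ z ∷ zs)            ≡⟨ front ⟩
  x ∷ y ∷ z ∷ zs                       ≡⟨ cong (x ∷_) (ins-> zs (≰⇒> y≰z)) ⟨
  x ∷ insertDesc y (z ∷ zs)            ≡⟨ ins-≤ _ y≤x ⟨
  insertDesc y (x ∷ z ∷ zs)            ≡⟨ cong (insertDesc y) (ins-> zs (≰⇒> x≰z)) ⟨
  insertDesc y (insertDesc x (z ∷ zs)) ∎
  where
  open ≡-Reasoning
  front : insertDesc x (y ∷ z ∷ zs) ≡ x ∷ y ∷ z ∷ zs
  front with m≤n⇒m<n∨m≡n y≤x
  ... | inj₁ y<x  = ins-> (z ∷ zs) y<x
  ... | inj₂ refl = trans (ins-≤ (z ∷ zs) ≤-refl) (cong (y ∷_) (ins-> zs (≰⇒> x≰z)))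

ins-comm : ∀ x y zs → insertDesc x (insertDesc y zs) ≡ insertDesc y (insertDesc x zs)
ins-comm x y zs with ≤-total y x
... | inj₁ y≤x = ins-comm-≤ zs y≤x
... | inj₂ x≤y = sym (ins-comm-≤ zs x≤y)

All-≤-mono : ∀ {x y} {zs : List ℕ} → x ≤ y → All (_≤ x) zs → All (_≤ y) zs
All-≤-mono x≤y []           = []
All-≤-mono x≤y (z≤x ∷ zs≤x) = ≤-trans z≤x x≤y ∷ All-≤-mono x≤y zs≤x

All-ins : ∀ {p} {P : ℕ → Set p} {x} ys → P x → All P ys → All P (insertDesc x ys)
All-ins []       Px []         = Px ∷ []
All-ins {x = x} (y ∷ ys) Px (Py ∷ Pys) with x ≤? y
... | yes x≤y rewrite ins-≤ ys x≤y = Py ∷ All-ins ys Px Pys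
... | no x≰y rewrite ins-> ys (≰⇒> x≰y) = Px ∷ Py ∷ Pys

ins-descending : ∀ x ys → Descending ys → Descending (insertDesc x ys)
ins-descending x []       []         = [] ∷ []
ins-descending x (y ∷ ys) (ys≤y ∷ d) with x ≤? y
... | yes x≤y rewrite ins-≤ ys x≤y = All-ins ys x≤y ys≤y ∷ ins-descending x ys d
... | no x≰y rewrite ins-> ys (≰⇒> x≰y) = (y≤x ∷ All-≤-mono y≤x ys≤y) ∷ ys≤y ∷ d
  where y≤x = <⇒≤ (≰⇒> x≰y)

vplus-descending : ∀ v → Descending (vplus v)
vplus-descending []       = []
vplus-descending (x ∷ xs) = ins-descending x (vplus xs) (vplus-descending xs)

vplus-id : ∀ {u} → Descending u → vplus u ≡ u
vplus-id []              = refl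
vplus-id {x ∷ xs} (xs≤x ∷ d) = trans (cong (insertDesc x) (vplus-id d)) (ins-front xs xs≤x)

length-vplus : ∀ v → length (vplus v) ≡ length v
length-vplus []       = refl
length-vplus (x ∷ xs) = trans (length-ins (vplus xs)) (cong suc (length-vplus xs))
  where
  length-ins : ∀ ys → length (insertDesc x ys) ≡ suc (length ys)
  length-ins []       = refl
  length-ins (y ∷ ys) with x ≤? y
  ... | yes x≤y rewrite ins-≤ ys x≤y = cong suc (length-ins ys)
  ... | no x≰y rewrite ins-> ys (≰⇒> x≰y) = refl

count-vplus : ∀ {p} {P : Pred ℕ p} (P? : Decidable P) v → count P? (vplus v) ≡ count P? v
count-vplus P? []       = refl
count-vplus P? (x ∷ xs) = begin
  count P? (insertDesc x (vplus xs)) ≡⟨ count-ins (vplus xs) ⟩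
  indicator (P? x) + count P? (vplus xs) ≡⟨ cong (indicator (P? x) +_) (count-vplus P? xs) ⟩
  indicator (P? x) + count P? xs ≡⟨ count-∷ P? x xs ⟨
  count P? (x ∷ xs) ∎
  where
  open ≡-Reasoning
  count-ins : ∀ ys → count P? (insertDesc x ys) ≡ indicator (P? x) + count P? ys
  count-ins []       = count-∷ P? x []
  count-ins (y ∷ ys) with x ≤? y
  ... | no x≰y rewrite ins-> ys (≰⇒> x≰y) = count-∷ P? x (y ∷ ys)
  ... | yes x≤y rewrite ins-≤ ys x≤y = begin
    count P? (y ∷ insertDesc x ys)           ≡⟨ count-∷ P? y _ ⟩
    [y] + count P? (insertDesc x ys)         ≡⟨ cong ([y] +_) (count-ins ys) ⟩
    [y] + ([x] + count P? ys)                ≡⟨ +-assoc [y] [x] _ ⟨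
    ([y] + [x]) + count P? ys                ≡⟨ cong (_+ count P? ys) (+-comm [y] [x]) ⟩
    ([x] + [y]) + count P? ys                ≡⟨ +-assoc [x] [y] _ ⟩
    [x] + ([y] + count P? ys)                ≡⟨ cong ([x] +_) (count-∷ P? y ys) ⟨
    [x] + count P? (y ∷ ys)                  ∎
    where [x] = indicator (P? x)
          [y] = indicator (P? y)

vplus-swapAt : ∀ v i → vplus (swapAt v i) ≡ vplus v
vplus-swapAt []           i             = refl
vplus-swapAt (x ∷ [])     i             = refl
vplus-swapAt (x ∷ y ∷ xs) zero          = refl
vplus-swapAt (x ∷ y ∷ xs) (suc zero)    = ins-comm y x (vplus xs)
vplus-swapAt (x ∷ y ∷ xs) (suc (suc k)) = cong (insertDesc x) (vplus-swapAt (y ∷ xs) (suc k))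

length-swapAt : ∀ v i → length (swapAt v i) ≡ length v
length-swapAt []           i             = refl
length-swapAt (x ∷ [])     i             = refl
length-swapAt (x ∷ y ∷ xs) zero          = refl
length-swapAt (x ∷ y ∷ xs) (suc zero)    = refl
length-swapAt (x ∷ y ∷ xs) (suc (suc k)) = cong suc (length-swapAt (y ∷ xs) (suc k))

length-psi : ∀ v → length (psi v) ≡ length v
length-psi []       = refl
length-psi (x ∷ xs) = trans (length-++ xs) (+-comm (length xs) 1)

-- every entry of xs is bounded by m; positions outside xs read as 0
at-≤ : ∀ {m xs} → All (_≤ m) xs → ∀ j → at xs j ≤ m
at-≤ []           j             = z≤n
at-≤ (x≤m ∷ _)    zero          = z≤n
at-≤ (x≤m ∷ _)    (suc zero)    = x≤m
at-≤ (_ ∷ xs≤m)   (suc (suc k)) = at-≤ xs≤m (suc k)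

descending-at : ∀ {u} i j → Descending u → 1 ≤ i → i ≤ j → at u j ≤ at u i
descending-at {[]}     i             j             d          _ _ = z≤n
descending-at {x ∷ xs} (suc zero)    (suc zero)    d          _ _ = ≤-refl
descending-at {x ∷ xs} (suc zero)    (suc (suc k)) (xs≤x ∷ _) _ _ = at-≤ xs≤x (suc k)
descending-at {x ∷ xs} (suc (suc i)) (suc (suc k)) (_ ∷ d)    _ (s≤s i≤k) =
  descending-at (suc i) (suc k) d (s≤s z≤n) i≤k

count-take-≤ : ∀ {p} {P : Pred ℕ p} (P? : Decidable P) n v → count P? (take n v) ≤ count P? v
count-take-≤ P? zero    v        = z≤n
count-take-≤ P? (suc n) []       = z≤n
count-take-≤ P? (suc n) (x ∷ xs) rewrite count-∷ P? x (take n xs) | count-∷ P? x xs =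
  +-monoʳ-≤ (indicator (P? x)) (count-take-≤ P? n xs)

count-take-step : ∀ {p} {P : Pred ℕ p} (P? : Decidable P) i v → 1 ≤ i → i ≤ length v →
  count P? (take i v) ≡ count P? (take (i ∸ 1) v) + indicator (P? (at v i))
count-take-step P? (suc zero) (x ∷ xs) _ _ rewrite count-∷ P? x [] = +-comm (indicator (P? x)) 0
count-take-step P? (suc (suc k)) (x ∷ xs) _ (s≤s k<n)
  rewrite count-∷ P? x (take (suc k) xs) | count-∷ P? x (take k xs)
        | count-take-step P? (suc k) xs (s≤s z≤n) k<n = sym (+-assoc (indicator (P? x)) _ _)

indicator-refl : ∀ t → indicator (t ≟ t) ≡ 1
indicator-refl t with t ≟ t
... | yes _  = refl
... | no t≢t = ⊥-elim (t≢t refl)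

count-none-> : ∀ t ys → All (_≤ t) ys → count (t <?_) ys ≡ 0
count-none-> t []       []          = refl
count-none-> t (y ∷ ys) (y≤t ∷ ys≤t) rewrite count-∷ (t <?_) y ys with t <? y
... | yes t<y = ⊥-elim (<⇒≱ t<y y≤t)
... | no _    = count-none-> t ys ys≤t

count-none-≡ : ∀ t ys → All (_< t) ys → count (_≟ t) ys ≡ 0
count-none-≡ t []       []          = refl
count-none-≡ t (y ∷ ys) (y<t ∷ ys<t) rewrite count-∷ (_≟ t) y ys with y ≟ t
... | yes y≡t = ⊥-elim (<⇒≢ y<t y≡t)
... | no _    = count-none-≡ t ys ys<t

at-descending-block : ∀ t w e → Descending w → e < count (_≟ t) w →
  at w (suc (count (t <?_) w + e)) ≡ t
at-descending-block t (y ∷ ys) e (ys≤y ∷ d) e<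
  rewrite count-∷ (t <?_) y ys | count-∷ (_≟ t) y ys with t <? y | y ≟ t
... | yes t<y | yes y≡t = ⊥-elim (<⇒≢ t<y (sym y≡t))
... | yes t<y | no _    = at-descending-block t ys e d e<
... | no _    | yes refl rewrite count-none-> y ys ys≤y with e
...   | zero   = refl
...   | suc e' = subst (λ g → at ys (suc (g + e')) ≡ y) (count-none-> y ys ys≤y)
                   (at-descending-block y ys e' d (≤-pred e<))
at-descending-block t (y ∷ ys) e (ys≤y ∷ d) e< | no t≮y | no y≢t =
  ⊥-elim (<⇒≱ e< (subst (_≤ e) (sym (count-none-≡ t ys ys<t)) z≤n))
  where
  y<t = ≤∧≢⇒< (≮⇒≥ t≮y) y≢t
  ys<t = All.map (λ z≤y → ≤-<-trans z≤y y<t) ys≤y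

at-vplus-sigma : ∀ v i → 1 ≤ i → i ≤ length v → at (vplus v) (sigma v i) ≡ at v i
at-vplus-sigma v i 1≤i i≤n =
  subst (λ g → at (vplus v) (suc (g + before)) ≡ t) (count-vplus (t <?_) v)
    (at-descending-block t (vplus v) before (vplus-descending v) before<)
  where
  t = at v i
  before = count (_≟ t) (take (i ∸ 1) v)
  before< : before < count (_≟ t) (vplus v)
  before< = begin-strict
    before                                     <⟨ m<m+n before (s≤s z≤n) ⟩
    before + 1                                 ≡⟨ cong (before +_) (indicator-refl t) ⟨
    before + indicator (t ≟ t)                 ≡⟨ count-take-step (_≟ t) i v 1≤i i≤n ⟨
    count (_≟ t) (take i v)                    ≤⟨ count-take-≤ (_≟ t) i v ⟩
    count (_≟ t) v                             ≡⟨ count-vplus (_≟ t) v ⟨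
    count (_≟ t) (vplus v)                     ∎
    where open ≤-Reasoning

sigma-suc : ∀ v i → 1 ≤ i → suc i ≤ length v → at v i ≡ at v (suc i) →
  sigma v (suc i) ≡ suc (sigma v i)
sigma-suc v i 1≤i i<n eq
  rewrite sym eq | count-take-step (_≟ at v i) i v 1≤i (<⇒≤ i<n) | indicator-refl (at v i) =
  cong suc (trans (cong (larger +_) (+-comm before 1)) (+-suc larger before))
  where
  larger  = count (at v i <?_) v
  before  = count (_≟ at v i) (take (i ∸ 1) v)

sigma-descending : ∀ {u} i → Descending u → 1 ≤ i → i ≤ length u → sigma u i ≡ i
sigma-descending {u} (suc i) d 1≤i i≤n = cong suc (rank u (suc i) d 1≤i i≤n refl)
  where
  rank : ∀ u i {t} → Descending u → 1 ≤ i → i ≤ length u → at u i ≡ t →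
    count (t <?_) u + count (_≟ t) (take (i ∸ 1) u) ≡ i ∸ 1
  rank (y ∷ ys) (suc zero) (ys≤y ∷ _) _ _ refl rewrite count-∷ (y <?_) y ys with y <? y
  ... | yes y<y = ⊥-elim (n≮n y y<y)
  ... | no _    = trans (+-identityʳ _) (count-none-> y ys ys≤y)
  rank (y ∷ ys) (suc (suc k)) {t} (ys≤y ∷ d) _ (s≤s k<n) eq
    rewrite count-∷ (t <?_) y ys | count-∷ (_≟ t) y (take k ys) with t <? y | y ≟ t
  ... | yes t<y | yes y≡t = ⊥-elim (<⇒≢ t<y (sym y≡t))
  ... | yes t<y | no _    = cong suc (rank ys (suc k) d (s≤s z≤n) k<n eq)
  ... | no _    | yes _   = trans (+-suc _ _) (cong suc (rank ys (suc k) d (s≤s z≤n) k<n eq))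
  ... | no t≮y  | no y≢t  = ⊥-elim (y≢t (≤-antisym (≮⇒≥ t≮y) t≤y))
    where t≤y = subst (_≤ y) eq (at-≤ ys≤y (suc k))

swapLbl-a : ∀ a → swapLbl a a ≡ suc a
swapLbl-a a = cong (if_then suc a else (if does (a ≟ suc a) then a else a)) (dec-true (a ≟ a) refl)

swapLbl-suc : ∀ a → swapLbl a (suc a) ≡ a
swapLbl-suc a = trans
  (cong (if_then suc a else (if does (suc a ≟ suc a) then a else suc a)) (dec-false (suc a ≟ a) (1+n≢n)))
  (cong (if_then a else suc a) (dec-true (suc a ≟ suc a) refl))

swapLbl-other : ∀ a x → x ≢ a → x ≢ suc a → swapLbl a x ≡ x
swapLbl-other a x x≢a x≢1+a = trans
  (cong (if_then suc a else (if does (x ≟ suc a) then a else x)) (dec-false (x ≟ a) x≢a))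
  (cong (if_then a else x) (dec-false (x ≟ suc a) x≢1+a))

data LabelCase (a x : ℕ) : Set where
  is-a     : x ≡ a → LabelCase a x
  is-suc-a : x ≡ suc a → LabelCase a x
  is-other : x ≢ a → x ≢ suc a → LabelCase a x

labelCase : ∀ a x → LabelCase a x
labelCase a x with x ≟ a | x ≟ suc a
... | yes x≡a | _         = is-a x≡a
... | no _    | yes x≡1+a = is-suc-a x≡1+a
... | no x≢a  | no x≢1+a  = is-other x≢a x≢1+a

swapLbl-involutive : ∀ a x → swapLbl a (swapLbl a x) ≡ x
swapLbl-involutive a x with labelCase a x
... | is-a refl     = trans (cong (swapLbl a) (swapLbl-a a)) (swapLbl-suc a)
... | is-suc-a refl = trans (cong (swapLbl a) (swapLbl-suc a)) (swapLbl-a a)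
... | is-other x≢a x≢1+a =
  trans (cong (swapLbl a) (swapLbl-other a x x≢a x≢1+a)) (swapLbl-other a x x≢a x≢1+a)

swapLbl-< : ∀ a {x y} → y < x → ¬ (y ≡ a × x ≡ suc a) → swapLbl a y < swapLbl a x
swapLbl-< a {x} {y} y<x not-a,a+1 with labelCase a y | labelCase a x
... | is-a refl | is-a refl = ⊥-elim (n≮n y y<x)
... | is-a refl | is-suc-a refl = ⊥-elim (not-a,a+1 (refl , refl))
... | is-a refl | is-other x≢a x≢1+a
  rewrite swapLbl-a y | swapLbl-other y x x≢a x≢1+a = ≤∧≢⇒< y<x (λ e → x≢1+a (sym e))
... | is-suc-a refl | is-a refl = ⊥-elim (<-asym y<x (n<1+n x))
... | is-suc-a refl | is-suc-a refl = ⊥-elim (n≮n y y<x)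
... | is-suc-a refl | is-other x≢a x≢1+a
  rewrite swapLbl-suc a | swapLbl-other a x x≢a x≢1+a = <-trans (n<1+n a) y<x
... | is-other y≢a y≢1+a | is-a refl
  rewrite swapLbl-a x | swapLbl-other x y y≢a y≢1+a = <-trans y<x (n<1+n x)
... | is-other y≢a y≢1+a | is-suc-a refl
  rewrite swapLbl-suc a | swapLbl-other a y y≢a y≢1+a = ≤∧≢⇒< (≤-pred y<x) y≢a
... | is-other y≢a y≢1+a | is-other x≢a x≢1+a
  rewrite swapLbl-other a x x≢a x≢1+a | swapLbl-other a y y≢a y≢1+a = y<x

swapLbl-range : ∀ {N a x} → 1 ≤ a → suc a ≤ N → 1 ≤ x → x ≤ N →
  1 ≤ swapLbl a x × swapLbl a x ≤ N
swapLbl-range {N} {a} {x} 1≤a a<N 1≤x x≤N with labelCase a x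
... | is-a refl rewrite swapLbl-a x = s≤s z≤n , a<N
... | is-suc-a refl rewrite swapLbl-suc a = 1≤a , <⇒≤ a<N
... | is-other x≢a x≢1+a rewrite swapLbl-other a x x≢a x≢1+a = 1≤x , x≤N

at-swapLbl : ∀ w a → at w a ≡ at w (suc a) → ∀ x → at w (swapLbl a x) ≡ at w x
at-swapLbl w a eq x with labelCase a x
... | is-a refl rewrite swapLbl-a x = sym eq
... | is-suc-a refl rewrite swapLbl-suc a = eq
... | is-other x≢a x≢1+a rewrite swapLbl-other a x x≢a x≢1+a = refl

vplus-equal-at-sigma : ∀ v i → 1 ≤ i → suc i ≤ length v → at v i ≡ at v (suc i) →
  at (vplus v) (sigma v i) ≡ at (vplus v) (suc (sigma v i))
vplus-equal-at-sigma v i 1≤i i<n eq = begin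
  at (vplus v) (sigma v i)       ≡⟨ at-vplus-sigma v i 1≤i (<⇒≤ i<n) ⟩
  at v i                         ≡⟨ eq ⟩
  at v (suc i)                   ≡⟨ at-vplus-sigma v (suc i) (s≤s z≤n) i<n ⟨
  at (vplus v) (sigma v (suc i)) ≡⟨ cong (at (vplus v)) (sigma-suc v i 1≤i i<n eq) ⟩
  at (vplus v) (suc (sigma v i)) ∎
  where open ≡-Reasoning

Tfill-SEdge : ∀ {x y} → SEdge x y → Tfill x ≡ Tfill y
Tfill-SEdge {τ , v} (sv {i = i} _ _ _) =
  cong (λ w → map (map (at w)) τ) (sym (vplus-swapAt v i))
Tfill-SEdge {τ , v} (sτ {i = i} 1≤i i<n eq _) = begin
  map (map (at w)) τ                           ≡⟨ map-cong (map-cong (sym ∘ at-swapLbl w a w[a]≡w[a+1])) τ ⟩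
  map (map (at w ∘ swapLbl a)) τ               ≡⟨ map-cong (map-∘) τ ⟩
  map (map (at w) ∘ map (swapLbl a)) τ         ≡⟨ map-∘ τ ⟩
  map (map (at w)) (swapLabels τ a)            ∎
  where
  open ≡-Reasoning
  w = vplus v
  a = sigma v i
  w[a]≡w[a+1] = vplus-equal-at-sigma v i 1≤i i<n eq

Tfill-component : ∀ {N la x y} → SameComponent N la x y → Tfill x ≡ Tfill y
Tfill-component ε = refl
Tfill-component (fwd (_ , _ , e) ◅ es) = trans (Tfill-SEdge e) (Tfill-component es)
Tfill-component (bwd (_ , _ , e) ◅ es) = trans (sym (Tfill-SEdge e)) (Tfill-component es)

-- The content condition CT[a] - CT[b] ≥ 2 in natural-number form: for
-- a in cell (c,r) and b in cell (c',r') it reads 2 + (r + c') ≤ c + r'.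

module _ where
  open import Data.Integer as ℤ using (ℤ; +_; _⊖_; +≤+)
  import Data.Integer.Properties as ℤ
  import Data.Integer.Solver as ℤ-Solver

  content-difference : ∀ c r c' r' → (+ c ℤ.- + r) ℤ.- (+ c' ℤ.- + r') ≡ (c + r') ⊖ (r + c')
  content-difference c r c' r' = begin
    (+ c ℤ.- + r) ℤ.- (+ c' ℤ.- + r')   ≡⟨ regroup (+ c) (+ r) (+ c') (+ r') ⟩
    (+ c ℤ.+ + r') ℤ.- (+ r ℤ.+ + c')   ≡⟨ cong₂ ℤ._-_ (ℤ.pos-+ c r') (ℤ.pos-+ r c') ⟨
    + (c + r') ℤ.- + (r + c')           ≡⟨ ℤ.m-n≡m⊖n (c + r') (r + c') ⟩
    (c + r') ⊖ (r + c')                 ∎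
    where
    open ≡-Reasoning
    open ℤ-Solver.+-*-Solver
    regroup : ∀ c r c' r' → (c ℤ.- r) ℤ.- (c' ℤ.- r') ≡ (c ℤ.+ r') ℤ.- (r ℤ.+ c')
    regroup = solve 4 (λ c r c' r' → (c :- r) :- (c' :- r') := (c :+ r') :- (r :+ c')) refl

  ⊖≥2⇒ : ∀ m n → + 2 ℤ.≤ m ⊖ n → 2 + n ≤ m
  ⊖≥2⇒ m n 2≤m⊖n with n ≤? m
  ... | yes n≤m = subst (2 + n ≤_) (m∸n+n≡m n≤m)
                    (+-monoˡ-≤ n (ℤ.drop‿+≤+ (subst (+ 2 ℤ.≤_) (ℤ.⊖-≥ n≤m) 2≤m⊖n)))
  ... | no n≰m  = ⊥-elim (two≰negative (n ∸ m) (subst (+ 2 ℤ.≤_) (ℤ.⊖-≰ n≰m) 2≤m⊖n))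
    where
    two≰negative : ∀ k → ¬ (+ 2 ℤ.≤ ℤ.- (+ k))
    two≰negative zero    (+≤+ ())
    two≰negative (suc k) ()

  ⇒⊖≥2 : ∀ m n → 2 + n ≤ m → + 2 ℤ.≤ m ⊖ n
  ⇒⊖≥2 m n 2+n≤m = subst (+ 2 ℤ.≤_) (sym (ℤ.⊖-≥ n≤m))
                     (+≤+ (subst (_≤ m ∸ n) (m+n∸n≡m 2 n) (∸-monoˡ-≤ n 2+n≤m)))
    where n≤m = ≤-trans (m≤n+m n 2) 2+n≤m

  content-gap⇒ : ∀ c r c' r' → (+ c ℤ.- + r) ℤ.- (+ c' ℤ.- + r') ℤ.≥ + 2 → 2 + (r + c') ≤ c + r'
  content-gap⇒ c r c' r' gap = ⊖≥2⇒ _ _ (subst (+ 2 ℤ.≤_) (content-difference c r c' r') gap)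

  ⇒content-gap : ∀ c r c' r' → 2 + (r + c') ≤ c + r' → (+ c ℤ.- + r) ℤ.- (+ c' ℤ.- + r') ℤ.≥ + 2
  ⇒content-gap c r c' r' gap = subst (+ 2 ℤ.≤_) (sym (content-difference c r c' r')) (⇒⊖≥2 _ _ gap)

  content-gap? : ∀ c r c' r' → Dec ((+ c ℤ.- + r) ℤ.- (+ c' ℤ.- + r') ℤ.≥ + 2)
  content-gap? c r c' r' = + 2 ℤ.≤? (+ c ℤ.- + r) ℤ.- (+ c' ℤ.- + r')

AtRow-functional : ∀ {row c x y} → AtRow row c x → AtRow row c y → x ≡ y
AtRow-functional here      here      = refl
AtRow-functional (there p) (there q) = AtRow-functional p q

At-functional : ∀ {τ c r x y} → At τ c r x → At τ c r y → x ≡ y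
At-functional (here p)  (here q)  = AtRow-functional p q
At-functional (there p) (there q) = At-functional p q

rowLength : Filling → ℕ → ℕ
rowLength τ r = at (map length τ) r

AtRow-bound : ∀ {row c x} → AtRow row c x → 1 ≤ c × c ≤ length row
AtRow-bound here      = s≤s z≤n , s≤s z≤n
AtRow-bound (there p) = s≤s z≤n , s≤s (proj₂ (AtRow-bound p))

At-bound : ∀ {τ c r x} → At τ c r x → 1 ≤ c × 1 ≤ r × c ≤ rowLength τ r
At-bound (here p) = proj₁ (AtRow-bound p) , s≤s z≤n , proj₂ (AtRow-bound p)
At-bound (there p) with At-bound p
... | 1≤c , s≤s z≤n , c≤len = 1≤c , s≤s z≤n , c≤len

AtRow-exists : ∀ row c → 1 ≤ c → c ≤ length row → ∃[ x ] AtRow row c x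
AtRow-exists (y ∷ ys) (suc zero)    _ _         = y , here
AtRow-exists (y ∷ ys) (suc (suc k)) _ (s≤s k<n) with AtRow-exists ys (suc k) (s≤s z≤n) k<n
... | x , p = x , there p

At-exists : ∀ τ c r → 1 ≤ c → 1 ≤ r → c ≤ rowLength τ r → ∃[ x ] At τ c r x
At-exists []           (suc c) (suc zero)    _ _ ()
At-exists []           (suc c) (suc (suc r)) _ _ ()
At-exists (row ∷ rows) c (suc zero) 1≤c _ c≤len with AtRow-exists row c 1≤c c≤len
... | x , p = x , here p
At-exists (row ∷ rows) c (suc (suc r)) 1≤c _ c≤len with At-exists rows c (suc r) 1≤c (s≤s z≤n) c≤len
... | x , p = x , there p

At-exists-same-shape : ∀ {σ σ' c r k} → map length σ ≡ map length σ' → At σ c r k → ∃[ k' ] At σ' c r k'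
At-exists-same-shape {σ} {σ'} {c} {r} shape p with At-bound p
... | 1≤c , 1≤r , c≤len = At-exists σ' c r 1≤c 1≤r (subst (c ≤_) (cong (λ l → at l r) shape) c≤len)

At-map : ∀ (f : ℕ → ℕ) {τ c r x} → At τ c r x → At (map (map f) τ) c r (f x)
At-map f (here p)  = here (row f p)
  where
  row : ∀ (f : ℕ → ℕ) {xs c x} → AtRow xs c x → AtRow (map f xs) c (f x)
  row f here      = here
  row f (there p) = there (row f p)
At-map f (there p) = there (At-map f p)

At-map⁻ : ∀ (f : ℕ → ℕ) τ {c r y} → At (map (map f) τ) c r y → ∃[ x ] (At τ c r x × f x ≡ y)
At-map⁻ f (xs ∷ rows) (here p) with row xs p
  where
  row : ∀ xs {c y} → AtRow (map f xs) c y → ∃[ x ] (AtRow xs c x × f x ≡ y)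
  row (x ∷ xs) here      = x , here , refl
  row (x ∷ xs) (there p) with row xs p
  ... | z , q , e = z , there q , e
... | z , q , e = z , here q , e
At-map⁻ f (xs ∷ rows) (there p) with At-map⁻ f rows p
... | z , q , e = z , there q , e

shape-map : ∀ (f : ℕ → ℕ) τ → map length (map (map f) τ) ≡ map length τ
shape-map f []          = refl
shape-map f (xs ∷ rows) = cong₂ _∷_ (length-map f xs) (shape-map f rows)

filling-ext : ∀ (τ τ' : Filling) → map length τ ≡ map length τ' →
  (∀ {c r x} → At τ c r x → At τ' c r x) → τ ≡ τ'
filling-ext []           []             _     _  = refl
filling-ext (xs ∷ rows)  (xs' ∷ rows')  shape ⊆  =
  cong₂ _∷_ (row-ext xs xs' (∷-injectiveˡ shape) (λ p → head (⊆ (here p))))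
            (filling-ext rows rows' (∷-injectiveʳ shape) (λ p → tail (⊆ (there p)) (proj₁ (proj₂ (At-bound p)))))
  where
  head : ∀ {row rows c x} → At (row ∷ rows) c 1 x → AtRow row c x
  head (here p) = p
  tail : ∀ {row rows c r x} → At (row ∷ rows) c (suc r) x → 1 ≤ r → At rows c r x
  tail (there p) _ = p
  row-ext : ∀ (xs xs' : List ℕ) → length xs ≡ length xs' →
    (∀ {c x} → AtRow xs c x → AtRow xs' c x) → xs ≡ xs'
  row-ext []       []       _   _ = refl
  row-ext (x ∷ xs) (y ∷ ys) len ⊆ =
    cong₂ _∷_ (AtRow-functional (⊆ here) here)
              (row-ext xs ys (suc-injective len) (λ p → untail (⊆ (there p)) (proj₁ (AtRow-bound p))))
    where
    untail : ∀ {c z} → AtRow (y ∷ ys) (suc c) z → 1 ≤ c → AtRow ys c z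
    untail (there p) _ = p

list-ext : ∀ (u u' : List ℕ) → length u ≡ length u' →
  (∀ k → 1 ≤ k → k ≤ length u → at u k ≡ at u' k) → u ≡ u'
list-ext []       []       _   _  = refl
list-ext (x ∷ xs) (y ∷ ys) len eq =
  cong₂ _∷_ (eq 1 (s≤s z≤n) (s≤s z≤n))
            (list-ext xs ys (suc-injective len) (λ { (suc k) _ k<n → eq (suc (suc k)) (s≤s z≤n) (s≤s k<n) }))

record IsRST (N : ℕ) (la : List ℕ) (τ : Filling) : Set where
  field
    shape     : map length τ ≡ la
    injective : ∀ {c r c' r' x} → At τ c r x → At τ c' r' x → c ≡ c' × r ≡ r'
    range     : ∀ {c r x} → At τ c r x → 1 ≤ x × x ≤ N
    onto      : ∀ {x} → 1 ≤ x → x ≤ N → ∃[ c ] ∃[ r ] At τ c r x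
    row-dec   : ∀ {c r x y} → At τ c r x → At τ (suc c) r y → y < x
    col-dec   : ∀ {c r x y} → At τ c r x → At τ c (suc r) y → y < x

gap-cells : ∀ {N la τ a b c r c' r'} → IsRST N la τ → ContentGap≥2 τ a b →
  At τ c r a → At τ c' r' b → 2 + (r + c') ≤ c + r'
gap-cells rst (c , r , c' , r' , pa , pb , gap) pa' pb'
  with IsRST.injective rst pa pa' | IsRST.injective rst pb pb'
... | refl , refl | refl , refl = content-gap⇒ c r c' r' gap

At-swapLabels : ∀ τ a {c r x} → At τ c r x → At (swapLabels τ a) c r (swapLbl a x)
At-swapLabels τ a = At-map (swapLbl a)

At-swapLabels⁻ : ∀ τ a {c r y} → At (swapLabels τ a) c r y → At τ c r (swapLbl a y)
At-swapLabels⁻ τ a {y = y} p with At-map⁻ (swapLbl a) τ p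
... | x , q , refl = subst (At τ _ _) (sym (swapLbl-involutive a x)) q

swapLabels-RST : ∀ {N la τ a} → IsRST N la τ → ContentGap≥2 τ a (suc a) →
  IsRST N la (swapLabels τ a)
swapLabels-RST {N} {la} {τ} {a} rst gap@(_ , _ , _ , _ , pa , pa+1 , _) = record
  { shape     = trans (shape-map (swapLbl a) τ) (IsRST.shape rst)
  ; injective = λ p q → IsRST.injective rst (back p) (back q)
  ; range     = range
  ; onto      = onto
  ; row-dec   = λ {c} {r} p q →
      decrease p q (≤-reflexive (cong suc (+-comm c r))) (IsRST.row-dec rst (back p) (back q))
  ; col-dec   = λ {c} {r} p q →
      decrease p q (≤-trans (≤-reflexive (+-comm c r)) (m≤n+m _ 2)) (IsRST.col-dec rst (back p) (back q))
  }
  where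
  τ' = swapLabels τ a
  back : ∀ {c r y} → At τ' c r y → At τ c r (swapLbl a y)
  back = At-swapLabels⁻ τ a
  1≤a = proj₁ (IsRST.range rst pa)
  a<N = proj₂ (IsRST.range rst pa+1)

  range : ∀ {c r x} → At τ' c r x → 1 ≤ x × x ≤ N
  range {x = x} p with IsRST.range rst (At-swapLabels⁻ τ a p)
  ... | 1≤ , ≤N = subst (λ z → 1 ≤ z × z ≤ N) (swapLbl-involutive a x) (swapLbl-range 1≤a a<N 1≤ ≤N)

  onto : ∀ {x} → 1 ≤ x → x ≤ N → ∃[ c ] ∃[ r ] At τ' c r x
  onto {x} 1≤x x≤N with swapLbl-range 1≤a a<N 1≤x x≤N
  ... | 1≤ , ≤N with IsRST.onto rst 1≤ ≤N
  ... | c , r , p = c , r , subst (At τ' c r) (swapLbl-involutive a x) (At-swapLabels τ a p)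

  -- a strict decrease between two cells survives the interchange unless it
  -- is a+1 > a with CT[a] ≥ CT[a+1] + 2, excluded when CT(c',r') ≤ CT(c,r) + 1
  decrease : ∀ {c r c' r' x y} → At τ' c r x → At τ' c' r' y → c' + r ≤ suc (r' + c) →
    swapLbl a y < swapLbl a x → y < x
  decrease {c} {r} {c'} {r'} {x} {y} p q close y<x-in-τ =
    subst₂ _<_ (swapLbl-involutive a y) (swapLbl-involutive a x) (swapLbl-< a y<x-in-τ not-a,a+1)
    where
    not-a,a+1 : ¬ (swapLbl a y ≡ a × swapLbl a x ≡ suc a)
    not-a,a+1 (ya , xa+1) = n≮n _ (≤-trans (gap-cells rst gap (at' q ya) (at' p xa+1)) close)
      where
      at' : ∀ {c r z w} → At τ' c r z → swapLbl a z ≡ w → At τ c r w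
      at' p refl = At-swapLabels⁻ τ a p

-- The column-reading filling τ_λ is an RST.  Its cell (c₀+1, r₀+1)
-- (0-based c₀, r₀) carries N - (cellsBefore λ c₀ + r₀).

-- the height of column c+1 of λ: the number of parts exceeding c
height : List ℕ → ℕ → ℕ
height la c = count (c <?_) la

⊓-suc : ∀ m c → m ⊓ suc c ≡ m ⊓ c + indicator (c <? m)
⊓-suc zero    c = refl
⊓-suc (suc m) zero with 0 <? suc m
... | yes _   = cong suc (⊓-zeroʳ m)
... | no 0≮m  = ⊥-elim (0≮m (s≤s z≤n))
⊓-suc (suc m) (suc c) with suc c <? suc m | c <? m | ⊓-suc m c
... | yes _   | yes _   | ih = cong suc ih
... | no _    | no _    | ih = cong suc ih
... | yes c<m | no c≮m  | _  = ⊥-elim (c≮m (≤-pred c<m))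
... | no c≮m  | yes c<m | _  = ⊥-elim (c≮m (s≤s c<m))

cellsBefore-suc : ∀ la c → cellsBefore la (suc c) ≡ cellsBefore la c + height la c
cellsBefore-suc []       c = refl
cellsBefore-suc (m ∷ ms) c rewrite count-∷ (c <?_) m ms | ⊓-suc m c | cellsBefore-suc ms c =
  interchange (m ⊓ c) (indicator (c <? m)) (cellsBefore ms c) (height ms c)
  where
  open +-*-Solver
  interchange : ∀ a b c d → (a + b) + (c + d) ≡ (a + c) + (b + d)
  interchange = solve 4 (λ a b c d → (a :+ b) :+ (c :+ d) := (a :+ c) :+ (b :+ d)) refl

cellsBefore-zero : ∀ la → cellsBefore la 0 ≡ 0
cellsBefore-zero []       = refl
cellsBefore-zero (m ∷ ms) rewrite ⊓-zeroʳ m = cellsBefore-zero ms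

cellsBefore-mono : ∀ la {c c'} → c ≤ c' → cellsBefore la c ≤ cellsBefore la c'
cellsBefore-mono []       c≤c' = z≤n
cellsBefore-mono (m ∷ ms) c≤c' = +-mono-≤ (⊓-monoʳ-≤ m c≤c') (cellsBefore-mono ms c≤c')

cellsBefore-≤-sum : ∀ la c → cellsBefore la c ≤ sum la
cellsBefore-≤-sum []       c = z≤n
cellsBefore-≤-sum (m ∷ ms) c = +-mono-≤ (m⊓n≤m m c) (cellsBefore-≤-sum ms c)

cellsBefore-all : ∀ la c → All (_≤ c) la → cellsBefore la c ≡ sum la
cellsBefore-all []       c []           = refl
cellsBefore-all (m ∷ ms) c (m≤c ∷ ms≤c) = cong₂ _+_ (m≤n⇒m⊓n≡m m≤c) (cellsBefore-all ms c ms≤c)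

parts-≤-sum : ∀ la → All (_≤ sum la) la
parts-≤-sum []       = []
parts-≤-sum (m ∷ ms) = m≤m+n m (sum ms) ∷ All-≤-mono (m≤n+m (sum ms) m) (parts-≤-sum ms)

in-shape⇒below-height : ∀ {la} → Descending la → ∀ r c → c < at la (suc r) → r < height la c
in-shape⇒below-height {m ∷ ms} (ms≤m ∷ d) r c c<len rewrite count-∷ (c <?_) m ms with c <? m | r
... | yes _   | zero  = s≤s z≤n
... | yes _   | suc r = s≤s (in-shape⇒below-height d r c c<len)
... | no c≮m  | zero  = ⊥-elim (c≮m c<len)
... | no c≮m  | suc r = ⊥-elim (c≮m (<-≤-trans c<len (at-≤ ms≤m (suc r))))

below-height⇒in-shape : ∀ {la} → Descending la → ∀ r c → r < height la c → c < at la (suc r)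
below-height⇒in-shape {m ∷ ms} (ms≤m ∷ d) r c r<h rewrite count-∷ (c <?_) m ms with c <? m | r
... | yes c<m | zero  = c<m
... | yes c<m | suc r = below-height⇒in-shape d r c (≤-pred r<h)
... | no c≮m  | _     =
  ⊥-elim (<⇒≱ r<h (subst (_≤ _) (sym (count-none-> c ms (All-≤-mono (≮⇒≥ c≮m) ms≤m))) z≤n))

AtRow-applyUpTo : ∀ (f : ℕ → ℕ) n {c x} → AtRow (applyUpTo f n) c x → x ≡ f (c ∸ 1)
AtRow-applyUpTo f (suc n) here = refl
AtRow-applyUpTo f (suc n) (there {c = c} p) with AtRow-bound p
... | s≤s z≤n , _ = AtRow-applyUpTo (f ∘ suc) n p

module _ (N : ℕ) (la : List ℕ) where

  tauRows-shape : ∀ r₀ ms → map length (tauRows N la r₀ ms) ≡ ms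
  tauRows-shape r₀ []       = refl
  tauRows-shape r₀ (m ∷ ms) =
    cong₂ _∷_ (trans (length-map _ (upTo m)) (length-upTo m)) (tauRows-shape (suc r₀) ms)

  tauRows-entry : ∀ r₀ ms {c r x} → At (tauRows N la r₀ ms) c r x →
    x ≡ N ∸ cellsBefore la (c ∸ 1) ∸ (r₀ + (r ∸ 1))
  tauRows-entry r₀ (m ∷ ms) {c} (here p) rewrite +-identityʳ r₀ =
    AtRow-applyUpTo (λ c → N ∸ cellsBefore la c ∸ r₀) m
      (subst (λ row → AtRow row c _) (map-upTo (λ c → N ∸ cellsBefore la c ∸ r₀) m) p)
  tauRows-entry r₀ (m ∷ ms) {c} (there {r = r} p) with At-bound p
  ... | _ , s≤s z≤n , _ rewrite +-suc r₀ (r ∸ 1) = tauRows-entry (suc r₀) ms p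

module StandardFilling (N : ℕ) (la : List ℕ) (d : Descending la) (sum≡N : sum la ≡ N) where

  τλ : Filling
  τλ = tauLambda N la

  -- the 0-based position of cell (c₀+1, r₀+1) in column-reading order
  index : ℕ → ℕ → ℕ
  index c₀ r₀ = cellsBefore la c₀ + r₀

  rowLength-τλ : ∀ r → rowLength τλ r ≡ at la r
  rowLength-τλ r = cong (λ l → at l r) (tauRows-shape N la 0 la)

  entry : ∀ {c₀ r₀ x} → At τλ (suc c₀) (suc r₀) x → x ≡ N ∸ index c₀ r₀
  entry {c₀} {r₀} p = trans (tauRows-entry N la 0 la p) (∸-+-assoc N (cellsBefore la c₀) r₀)

  index-in-column : ∀ {c₀ r₀ x} → At τλ (suc c₀) (suc r₀) x → index c₀ r₀ < cellsBefore la (suc c₀)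
  index-in-column {c₀} {r₀} p = subst (index c₀ r₀ <_) (sym (cellsBefore-suc la c₀))
    (+-monoʳ-< (cellsBefore la c₀) (in-shape⇒below-height d r₀ c₀ c₀<len))
    where c₀<len = subst (suc c₀ ≤_) (rowLength-τλ (suc r₀)) (proj₂ (proj₂ (At-bound p)))

  index<N : ∀ {c₀ r₀ x} → At τλ (suc c₀) (suc r₀) x → index c₀ r₀ < N
  index<N p = <-≤-trans (index-in-column p) (subst (_ ≤_) sum≡N (cellsBefore-≤-sum la _))

  range : ∀ {c r x} → At τλ c r x → 1 ≤ x × x ≤ N
  range p with At-bound p
  ... | s≤s {n = c₀} z≤n , s≤s {n = r₀} z≤n , _ rewrite entry p =
    m<n⇒0<n∸m (index<N p) , m∸n≤m N (index c₀ r₀)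

  entry-< : ∀ {c₀ r₀ c₁ r₁ x y} → At τλ (suc c₀) (suc r₀) x → At τλ (suc c₁) (suc r₁) y →
    index c₀ r₀ < index c₁ r₁ → y < x
  entry-< p q i<j rewrite entry p | entry q = ∸-monoʳ-< i<j (<⇒≤ (index<N q))

  -- going right moves to a later column, going up to the next index
  row-dec : ∀ {c r x y} → At τλ c r x → At τλ (suc c) r y → y < x
  row-dec p q with At-bound p
  ... | s≤s {n = c₀} z≤n , s≤s {n = r₀} z≤n , _ =
    entry-< p q (+-monoˡ-< r₀ (≤-<-trans (m≤m+n (cellsBefore la c₀) r₀) (index-in-column p)))

  col-dec : ∀ {c r x y} → At τλ c r x → At τλ c (suc r) y → y < x
  col-dec p q with At-bound p
  ... | s≤s {n = c₀} z≤n , s≤s {n = r₀} z≤n , _ = entry-< p q (+-monoʳ-< (cellsBefore la c₀) (n<1+n r₀))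

  -- distinct cells have distinct indices, so τ_λ is injective
  index-column-< : ∀ {c₀ r₀ c₁ r₁ x y} → At τλ (suc c₀) (suc r₀) x → At τλ (suc c₁) (suc r₁) y →
    c₀ < c₁ → index c₀ r₀ < index c₁ r₁
  index-column-< p q c₀<c₁ =
    <-≤-trans (index-in-column p) (≤-trans (cellsBefore-mono la c₀<c₁) (m≤m+n _ _))

  injective : ∀ {c r c' r' x} → At τλ c r x → At τλ c' r' x → c ≡ c' × r ≡ r'
  injective p q with At-bound p | At-bound q
  ... | s≤s z≤n , s≤s z≤n , _ | s≤s z≤n , s≤s z≤n , _ = same-cell p q (same-index p q)
    where
    same-index : ∀ {c₀ r₀ c₁ r₁ x} → At τλ (suc c₀) (suc r₀) x → At τλ (suc c₁) (suc r₁) x →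
      index c₀ r₀ ≡ index c₁ r₁
    same-index p q = ∸-cancelˡ-≡ (<⇒≤ (index<N p)) (<⇒≤ (index<N q)) (trans (sym (entry p)) (entry q))
    same-cell : ∀ {c₀ r₀ c₁ r₁ x} → At τλ (suc c₀) (suc r₀) x → At τλ (suc c₁) (suc r₁) x →
      index c₀ r₀ ≡ index c₁ r₁ → suc c₀ ≡ suc c₁ × suc r₀ ≡ suc r₁
    same-cell {c₀} {r₀} {c₁} {r₁} p q eq with <-cmp c₀ c₁
    ... | tri< c₀<c₁ _ _ = ⊥-elim (<⇒≢ (index-column-< p q c₀<c₁) eq)
    ... | tri> _ _ c₁<c₀ = ⊥-elim (<⇒≢ (index-column-< q p c₁<c₀) (sym eq))
    ... | tri≈ _ refl _  = refl , cong suc (+-cancelˡ-≡ _ _ _ eq)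

  column-of : ∀ K t → t < cellsBefore la K → ∃[ c₀ ] (cellsBefore la c₀ ≤ t × t < cellsBefore la (suc c₀))
  column-of zero    t t< = ⊥-elim (<⇒≱ t< (subst (_≤ t) (sym (cellsBefore-zero la)) z≤n))
  column-of (suc K) t t< with t <? cellsBefore la K
  ... | yes t<K = column-of K t t<K
  ... | no t≮K  = K , ≮⇒≥ t≮K , t<

  -- the label x sits at the cell of index N - x
  onto : ∀ {x} → 1 ≤ x → x ≤ N → ∃[ c ] ∃[ r ] At τλ c r x
  onto {x} 1≤x x≤N with column-of N (N ∸ x) t<all
    where
    all-cells : cellsBefore la N ≡ N
    all-cells = trans (cellsBefore-all la N (subst (λ K → All (_≤ K) la) sum≡N (parts-≤-sum la))) sum≡N
    t<all : N ∸ x < cellsBefore la N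
    t<all = subst (N ∸ x <_) (sym all-cells) (∸-monoʳ-< {o = 0} 1≤x x≤N)
  ... | c₀ , start≤t , t<end = suc c₀ , suc r₀ , subst (At τλ (suc c₀) (suc r₀)) value (proj₂ cell)
    where
    t = N ∸ x
    r₀ = t ∸ cellsBefore la c₀
    r₀<height : r₀ < height la c₀
    r₀<height = +-cancelˡ-< (cellsBefore la c₀) _ _
      (subst₂ _<_ (sym (m+[n∸m]≡n start≤t)) (cellsBefore-suc la c₀) t<end)
    cell : ∃[ y ] At τλ (suc c₀) (suc r₀) y
    cell = At-exists τλ (suc c₀) (suc r₀) (s≤s z≤n) (s≤s z≤n)
      (subst (suc c₀ ≤_) (sym (rowLength-τλ (suc r₀))) (below-height⇒in-shape d r₀ c₀ r₀<height))
    value : proj₁ cell ≡ x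
    value = trans (entry (proj₂ cell)) (trans (cong (N ∸_) (m+[n∸m]≡n start≤t)) (m∸[m∸n]≡n x≤N))

  isRST : IsRST N la τλ
  isRST = record
    { shape = tauRows-shape N la 0 la ; injective = injective ; range = range
    ; onto = onto ; row-dec = row-dec ; col-dec = col-dec }

partition-descending : ∀ {N la} → IsPartition N la → Descending la
partition-descending (_ , linked , _) = Linked⇒AllPairs (λ p q → ≤-trans q p) linked

VertexInvariant : ℕ → List ℕ → Vertex → Set
VertexInvariant N la (τ , v) = IsRST N la τ × length v ≡ N

invariant-step : ∀ {N la x y} → VertexInvariant N la x → GEdge x y → VertexInvariant N la y
invariant-step {x = τ , v} (rst , len) ψ                        = rst , trans (length-psi v) len
invariant-step {x = τ , v} (rst , len) (s (sv {i = i} _ _ _))    = rst , trans (length-swapAt v i) len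
invariant-step             (rst , len) (s (sτ _ _ _ gap))        = swapLabels-RST rst gap , len

vertex-invariant : ∀ {N la x} → IsPartition N la → IsVertex N la x → VertexInvariant N la x
vertex-invariant {N} {la} ip@(_ , _ , sum≡N) path = go path initial
  where
  initial : VertexInvariant N la (tauLambda N la , replicate N 0)
  initial = StandardFilling.isRST N la (partition-descending ip) sum≡N , length-replicate N
  go : ∀ {x y} → Star GEdge x y → VertexInvariant N la x → VertexInvariant N la y
  go ε         inv = inv
  go (e ◅ es)  inv = go es (invariant-step inv e)

SEdge-path-component : ∀ {N la x y} → IsVertex N la x → Star SEdge x y →
  SameComponent N la x y × IsVertex N la y
SEdge-path-component vx ε = ε , vx
SEdge-path-component vx (e ◅ es) with SEdge-path-component (vx ◅◅ (s e ◅ ε)) es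
... | comp , vy = fwd (vx , (vx ◅◅ (s e ◅ ε)) , e) ◅ comp , vy

data SortStep : List ℕ → List ℕ → Set where
  sort-step : ∀ {v} i → 1 ≤ i → suc i ≤ length v → at v i < at v (suc i) → SortStep v (swapAt v i)

SortStep-∷ : ∀ x {v w} → Star SortStep v w → Star SortStep (x ∷ v) (x ∷ w)
SortStep-∷ x ε = ε
SortStep-∷ x (sort-step {y ∷ ys} (suc k) _ i<n lt ◅ es) =
  sort-step (suc (suc k)) (s≤s z≤n) (s≤s i<n) lt ◅ SortStep-∷ x es

bubble : ∀ x ys → Descending ys → Star SortStep (x ∷ ys) (insertDesc x ys)
bubble x []       _ = ε
bubble x (y ∷ ys) (ys≤y ∷ d) with x ≤? y
... | no x≰y rewrite ins-> ys (≰⇒> x≰y) = ε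
... | yes x≤y rewrite ins-≤ ys x≤y with m≤n⇒m<n∨m≡n x≤y
...   | inj₁ x<y  = sort-step 1 (s≤s z≤n) (s≤s (s≤s z≤n)) x<y ◅ SortStep-∷ y (bubble x ys d)
...   | inj₂ refl rewrite ins-front ys ys≤y = ε

sort-path : ∀ v → Star SortStep v (vplus v)
sort-path []       = ε
sort-path (x ∷ xs) = SortStep-∷ x (sort-path xs) ◅◅ bubble x (vplus xs) (vplus-descending xs)

sort-SEdges : ∀ τ {v w} → Star SortStep v w → Star SEdge (τ , v) (τ , w)
sort-SEdges τ ε = ε
sort-SEdges τ (sort-step i 1≤i i<n lt ◅ es) = sv 1≤i i<n lt ◅ sort-SEdges τ es

sumTo : (ℕ → ℕ) → ℕ → ℕ
sumTo f zero    = 0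
sumTo f (suc n) = sumTo f n + f n

sumTo-cong : ∀ {f g} n → (∀ k → k < n → g k ≡ f k) → sumTo g n ≡ sumTo f n
sumTo-cong zero    eq = refl
sumTo-cong (suc n) eq = cong₂ _+_ (sumTo-cong n (λ k k<n → eq k (m<n⇒m<1+n k<n))) (eq n ≤-refl)

sumTo-pair-< : ∀ {f g} a n → suc a < n → (∀ k → k < n → k ≢ a → k ≢ suc a → g k ≡ f k) →
  g a + g (suc a) < f a + f (suc a) → sumTo g n < sumTo f n
sumTo-pair-< {f} {g} a (suc m) a+1<n same pair< with m≤n⇒m<n∨m≡n (≤-pred a+1<n)
... | inj₁ a+1<m = +-mono-<-≤ (sumTo-pair-< a m a+1<m (λ k k<m → same k (m<n⇒m<1+n k<m)) pair<)
                              (≤-reflexive (same m ≤-refl (λ m≡a → <⇒≢ (<-trans (n<1+n a) a+1<m) (sym m≡a))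
                                                           (λ m≡a+1 → <⇒≢ a+1<m (sym m≡a+1))))
... | inj₂ refl = begin-strict
  (sumTo g a + g a) + g (suc a)   ≡⟨ +-assoc (sumTo g a) _ _ ⟩
  sumTo g a + (g a + g (suc a))   ≡⟨ cong (_+ _) (sumTo-cong a below) ⟩
  sumTo f a + (g a + g (suc a))   <⟨ +-monoʳ-< (sumTo f a) pair< ⟩
  sumTo f a + (f a + f (suc a))   ≡⟨ +-assoc (sumTo f a) _ _ ⟨
  (sumTo f a + f a) + f (suc a)   ∎
  where
  open ≤-Reasoning
  below : ∀ k → k < a → g k ≡ f k
  below k k<a = same k (<-trans k<a (<-trans (n<1+n a) (n<1+n (suc a)))) (<⇒≢ k<a) (<⇒≢ (m<n⇒m<1+n k<a))

-- the weight of cell (c,r) is N - CT(c,r) = r + N - c, kept in ℕ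
weight : ℕ → ℕ → ℕ → ℕ
weight N c r = (r + N) ∸ c

weight-< : ∀ N c r c' r' → c ≤ N → c' ≤ N → 2 + (r + c') ≤ c + r' → weight N c r < weight N c' r'
weight-< N c r c' r' c≤N c'≤N gap = +-cancelʳ-< (c + c') _ _ (subst₂ _<_ (sym lhs) (sym rhs) shifted)
  where
  open +-*-Solver
  lhs : weight N c r + (c + c') ≡ (r + N) + c'
  lhs = trans (sym (+-assoc (weight N c r) c c')) (cong (_+ c') (m∸n+n≡m (≤-trans c≤N (m≤n+m N r))))
  rhs : weight N c' r' + (c + c') ≡ (r' + N) + c
  rhs = trans (cong (weight N c' r' +_) (+-comm c c'))
          (trans (sym (+-assoc (weight N c' r') c' c)) (cong (_+ c) (m∸n+n≡m (≤-trans c'≤N (m≤n+m N r')))))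
  regroup : ∀ x y z → y + (x + z) ≡ (x + y) + z
  regroup = solve 3 (λ x y z → y :+ (x :+ z) := (x :+ y) :+ z) refl
  shifted : (r + N) + c' < (r' + N) + c
  shifted = subst₂ _<_ (regroup r N c') (trans (cong (N +_) (+-comm c r')) (regroup r' N c))
              (+-monoʳ-< N (≤-trans (s≤s (n≤1+n _)) gap))

exchange-< : ∀ a x y → x < y → a * y + suc a * x < a * x + suc a * y
exchange-< a x y x<y =
  subst₂ _<_ (expand x y) (trans (cong (y +_) (+-comm (a * x) (a * y))) (expand y x))
    (+-monoˡ-< (a * x + a * y) x<y)
  where
  open +-*-Solver
  expand : ∀ p q → p + (a * p + a * q) ≡ a * q + suc a * p
  expand p q = solve 3 (λ a p q → p :+ (a :* p :+ a :* q) := a :* q :+ (con 1 :+ a) :* p) refl a p q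

module Potential (N : ℕ) (la : List ℕ) (sum≡N : sum la ≡ N) where

  column-≤ : ∀ {τ c r x} → IsRST N la τ → At τ c r x → c ≤ N
  column-≤ {τ} {c} {r} rst p = begin
    c                                 ≤⟨ proj₂ (proj₂ (At-bound p)) ⟩
    rowLength τ r                     ≡⟨ cong (λ l → at l r) (IsRST.shape rst) ⟩
    at la r                           ≤⟨ at-≤ (parts-≤-sum la) r ⟩
    sum la                            ≡⟨ sum≡N ⟩
    N                                 ∎
    where open ≤-Reasoning

  -- the weight of the cell carrying label k (0 outside 1,…,N)
  labelWeight : ∀ {τ} → IsRST N la τ → ℕ → ℕ
  labelWeight rst k with 1 ≤? k | k ≤? N
  ... | yes 1≤k | yes k≤N = weight N (proj₁ cell) (proj₁ (proj₂ cell))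
    where cell = IsRST.onto rst 1≤k k≤N
  ... | _       | _       = 0

  labelWeight-at : ∀ {τ c r k} (rst : IsRST N la τ) → At τ c r k → labelWeight rst k ≡ weight N c r
  labelWeight-at {k = k} rst p with 1 ≤? k | k ≤? N
  ... | yes 1≤k | yes k≤N with IsRST.onto rst 1≤k k≤N
  ...   | c' , r' , p' with IsRST.injective rst p' p
  ...     | refl , refl = refl
  labelWeight-at rst p | no 1≰k | _      = ⊥-elim (1≰k (proj₁ (IsRST.range rst p)))
  labelWeight-at rst p | yes _  | no k≰N = ⊥-elim (k≰N (proj₂ (IsRST.range rst p)))

  potential : ∀ {τ} → IsRST N la τ → ℕ
  potential rst = sumTo (λ k → k * labelWeight rst k) (suc N)

  -- only the weights of a and a+1 change, and they are exchanged
  potential-swap : ∀ {τ a} (rst : IsRST N la τ) (gap : ContentGap≥2 τ a (suc a)) →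
    potential (swapLabels-RST rst gap) < potential rst
  potential-swap {τ} {a} rst gap@(c₀ , r₀ , c₁ , r₁ , pa , pa+1 , _) =
    sumTo-pair-< a (suc N) (s≤s a+1≤N) unchanged exchanged
    where
    rst' = swapLabels-RST rst gap
    τ' = swapLabels τ a
    a+1≤N = proj₂ (IsRST.range rst pa+1)
    pa'   = subst (At τ' c₁ r₁) (swapLbl-suc a) (At-swapLabels τ a pa+1)
    pa+1' = subst (At τ' c₀ r₀) (swapLbl-a a) (At-swapLabels τ a pa)
    exchanged : a * labelWeight rst' a + suc a * labelWeight rst' (suc a)
              < a * labelWeight rst a + suc a * labelWeight rst (suc a)
    exchanged rewrite labelWeight-at rst pa | labelWeight-at rst pa+1
                    | labelWeight-at rst' pa' | labelWeight-at rst' pa+1' =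
      exchange-< a _ _ (weight-< N c₀ r₀ c₁ r₁ (column-≤ rst pa) (column-≤ rst pa+1) (gap-cells rst gap pa pa+1))
    unchanged : ∀ k → k < suc N → k ≢ a → k ≢ suc a →
      k * labelWeight rst' k ≡ k * labelWeight rst k
    unchanged zero    _   _   _     = refl
    unchanged (suc k) k<N k≢a k≢a+1 with IsRST.onto rst' (s≤s z≤n) (≤-pred k<N)
    ... | c , r , p = cong (suc k *_) (trans (labelWeight-at rst' p)
                        (sym (labelWeight-at rst (subst (At τ c r) (swapLbl-other a (suc k) k≢a k≢a+1)
                                                       (At-swapLabels⁻ τ a p)))))

-- for descending u, (τ,u) has an s_i-edge of the second kind (σ_u[i] = i)
Swappable : List ℕ → Filling → ℕ → Set
Swappable u τ i = at u i ≡ at u (suc i) × ContentGap≥2 τ i (suc i)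

IsSink : ℕ → List ℕ → Filling → Set
IsSink N u τ = ∀ i → 1 ≤ i → suc i ≤ N → ¬ Swappable u τ i

module Sinks (N : ℕ) (la : List ℕ) (sum≡N : sum la ≡ N)
             (u : List ℕ) (du : Descending u) (|u|≡N : length u ≡ N) where
  open Potential N la sum≡N

  swap-edge : ∀ {τ i} → 1 ≤ i → suc i ≤ N → Swappable u τ i → SEdge (τ , u) (swapLabels τ i , u)
  swap-edge {τ} {i} 1≤i i<N (eq , gap) =
    subst (λ a → SEdge (τ , u) (swapLabels τ a , u)) σ≡id
      (sτ 1≤i i<|u| eq (subst (λ a → ContentGap≥2 τ a (suc a)) (sym σ≡id) gap))
    where
    i<|u| = subst (suc i ≤_) (sym |u|≡N) i<N
    σ≡id = sigma-descending i du 1≤i (<⇒≤ i<|u|)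

  gap? : ∀ {τ a} → IsRST N la τ → 1 ≤ a → suc a ≤ N → Dec (ContentGap≥2 τ a (suc a))
  gap? rst 1≤a a<N with IsRST.onto rst 1≤a (<⇒≤ a<N) | IsRST.onto rst (s≤s z≤n) a<N
  ... | c , r , pa | c' , r' , pa+1 with content-gap? c r c' r'
  ...   | yes gap = yes (c , r , c' , r' , pa , pa+1 , gap)
  ...   | no ¬gap = no λ gap → ¬gap (⇒content-gap c r c' r' (gap-cells rst gap pa pa+1))

  swappable? : ∀ {τ i} → IsRST N la τ → 1 ≤ i → suc i ≤ N → Dec (Swappable u τ i)
  swappable? {i = i} rst 1≤i i<N with at u i ≟ at u (suc i) | gap? rst 1≤i i<N
  ... | yes eq | yes gap = yes (eq , gap)
  ... | no ¬eq | _       = no (¬eq ∘ proj₁)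
  ... | _      | no ¬gap = no (¬gap ∘ proj₂)

  search : ∀ {τ} → IsRST N la τ → ∀ K → K ≤ N →
    (∀ i → 1 ≤ i → suc i ≤ K → ¬ Swappable u τ i) ⊎ ∃[ i ] (1 ≤ i × suc i ≤ N × Swappable u τ i)
  search rst zero          _   = inj₁ λ _ _ ()
  search rst (suc zero)    _   = inj₁ λ { _ (s≤s z≤n) (s≤s ()) }
  search rst (suc (suc K)) K<N with search rst (suc K) (<⇒≤ K<N) | swappable? rst (s≤s z≤n) K<N
  ... | inj₂ found | _      = inj₂ found
  ... | inj₁ _     | yes sw = inj₂ (suc K , s≤s z≤n , K<N , sw)
  ... | inj₁ none  | no ¬sw = inj₁ λ i 1≤i i<K → case m≤n⇒m<n∨m≡n (≤-pred i<K) of λ where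
        (inj₁ i<K)  → none i 1≤i i<K
        (inj₂ refl) → ¬sw

  record SinkFrom (τ : Filling) : Set where
    field
      τ*   : Filling
      rst  : IsRST N la τ*
      sink : IsSink N u τ*
      path : Star SEdge (τ , u) (τ* , u)

  reach-sink : ∀ {τ} → IsRST N la τ → SinkFrom τ
  reach-sink rst = descend (suc (potential rst)) rst ≤-refl
    where
    descend : ∀ n {τ} (rst : IsRST N la τ) → potential rst < n → SinkFrom τ
    descend (suc n) {τ} rst μ<n with search rst N ≤-refl
    ... | inj₁ none = record { τ* = τ ; rst = rst ; sink = none ; path = ε }
    ... | inj₂ (i , 1≤i , i<N , sw@(_ , gap)) =
      record { SinkFrom next ; path = swap-edge 1≤i i<N sw ◅ SinkFrom.path next }
      where next = descend n (swapLabels-RST rst gap) (≤-trans (potential-swap rst gap) (≤-pred μ<n))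

Precedes : ℕ → ℕ → ℕ → ℕ → Set
Precedes c' r' c r = r' < r ⊎ (r' ≡ r × c' < c)

Precedes-trans : ∀ {c₁ r₁ c₂ r₂ c₃ r₃} → Precedes c₁ r₁ c₂ r₂ → Precedes c₂ r₂ c₃ r₃ → Precedes c₁ r₁ c₃ r₃
Precedes-trans (inj₁ r₁<r₂)          (inj₁ r₂<r₃)          = inj₁ (<-trans r₁<r₂ r₂<r₃)
Precedes-trans (inj₁ r₁<r₂)          (inj₂ (refl , _))     = inj₁ r₁<r₂
Precedes-trans (inj₂ (refl , _))     (inj₁ r₂<r₃)          = inj₁ r₂<r₃
Precedes-trans (inj₂ (refl , c₁<c₂)) (inj₂ (refl , c₂<c₃)) = inj₂ (refl , <-trans c₁<c₂ c₂<c₃)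

Precedes-asym : ∀ {c r c' r'} → Precedes c' r' c r → ¬ Precedes c r c' r'
Precedes-asym (inj₁ r'<r)          (inj₁ r<r')          = <-asym r'<r r<r'
Precedes-asym (inj₁ r'<r)          (inj₂ (refl , _))    = n≮n _ r'<r
Precedes-asym (inj₂ (refl , _))    (inj₁ r<r')          = n≮n _ r<r'
Precedes-asym (inj₂ (refl , c'<c)) (inj₂ (_ , c<c'))    = <-asym c'<c c<c'

module RSTOrder {N la} (d : Descending la) {τ} (rst : IsRST N la τ) where

  rowLength≡ : ∀ r → rowLength τ r ≡ at la r
  rowLength≡ r = cong (λ l → at l r) (IsRST.shape rst)

  row-≤ : ∀ {c c' r x y} → At τ c r x → At τ c' r y → c ≤′ c' → y ≤ x
  row-≤ p q ≤′-refl = ≤-reflexive (At-functional q p)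
  row-≤ {c} {suc c''} {r} p q (≤′-step c≤c'') with At-bound p | At-bound q
  ... | 1≤c , 1≤r , _ | _ , _ , c'≤len with At-exists τ c'' r (≤-trans 1≤c (≤′⇒≤ c≤c'')) 1≤r (<⇒≤ c'≤len)
  ...   | z , pz = ≤-trans (<⇒≤ (IsRST.row-dec rst pz q)) (row-≤ p pz c≤c'')

  col-≤ : ∀ {c r r' x y} → At τ c r x → At τ c r' y → r ≤′ r' → y ≤ x
  col-≤ p q ≤′-refl = ≤-reflexive (At-functional q p)
  col-≤ {c} {r} {suc r''} p q (≤′-step r≤r'') with At-bound p | At-bound q
  ... | _ , 1≤r , _ | 1≤c , _ , c≤len with At-exists τ c r'' 1≤c (≤-trans 1≤r (≤′⇒≤ r≤r'')) c≤len''
    where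
    c≤len'' = subst (c ≤_) (sym (rowLength≡ r''))
                (≤-trans (subst (c ≤_) (rowLength≡ (suc r'')) c≤len)
                         (descending-at r'' (suc r'') d (≤-trans 1≤r (≤′⇒≤ r≤r'')) (n≤1+n r'')))
  ...   | z , pz = ≤-trans (<⇒≤ (IsRST.col-dec rst pz q)) (col-≤ p pz r≤r'')

  quadrant-≤ : ∀ {c r c' r' x y} → At τ c r x → At τ c' r' y → c ≤ c' → r ≤ r' → y ≤ x
  quadrant-≤ {c} {r} {c'} {r'} p q c≤c' r≤r' with At-bound p | At-bound q
  ... | _ , 1≤r , _ | 1≤c' , _ , c'≤len with At-exists τ c' r 1≤c' 1≤r c'≤len-r
    where
    c'≤len-r = subst (c' ≤_) (sym (rowLength≡ r))
                 (≤-trans (subst (c' ≤_) (rowLength≡ r') c'≤len) (descending-at r r' d 1≤r r≤r'))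
  ...   | z , pz = ≤-trans (col-≤ pz q (≤⇒≤′ r≤r')) (row-≤ p pz (≤⇒≤′ c≤c'))

  next-precedes : ∀ {k c r c' r'} → ¬ ContentGap≥2 τ k (suc k) →
    At τ c r k → At τ c' r' (suc k) → Precedes c' r' c r
  next-precedes {k} {c} {r} {c'} {r'} no-gap p q with <-cmp r' r
  ... | tri< r'<r _ _ = inj₁ r'<r
  ... | tri≈ _ refl _ with <-cmp c' c
  ...   | tri< c'<c _ _ = inj₂ (refl , c'<c)
  ...   | tri≈ _ refl _ = ⊥-elim (1+n≢n (At-functional q p))
  ...   | tri> _ _ c<c' = ⊥-elim (n≮n k (quadrant-≤ p q (<⇒≤ c<c') ≤-refl))
  next-precedes {k} {c} {r} {c'} {r'} no-gap p q | tri> _ _ r<r' with c ≤? c'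
  ... | yes c≤c' = ⊥-elim (n≮n k (quadrant-≤ p q c≤c' (<⇒≤ r<r')))
  ... | no c≰c'  = ⊥-elim (no-gap (c , r , c' , r' , p , q , ⇒content-gap c r c' r' gap))
    where
    gap : 2 + (r + c') ≤ c + r'
    gap = subst₂ _≤_ (cong suc (+-suc r c')) (+-comm r' c) (+-mono-≤ r<r' (≰⇒> c≰c'))

  equal-values-precede : ∀ {u} → Descending u → IsSink N u τ →
    ∀ {k m c r c' r'} → 1 ≤ k → suc k ≤′ m → m ≤ N → at u k ≡ at u m →
    At τ c r k → At τ c' r' m → Precedes c' r' c r
  equal-values-precede du sink {k} 1≤k ≤′-refl m≤N eq p q =
    next-precedes (λ gap → sink k 1≤k m≤N (eq , gap)) p q
  equal-values-precede {u} du sink {k} 1≤k (≤′-step {n = m} k<m) m<N eq p q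
    with IsRST.onto rst (≤-trans (s≤s z≤n) (≤′⇒≤ k<m)) (<⇒≤ m<N)
  ... | _ , _ , pm = Precedes-trans (next-precedes (λ gap → sink m 1≤m m<N (u[m]≡u[m+1] , gap)) pm q)
                                    (equal-values-precede du sink 1≤k k<m (<⇒≤ m<N) u[k]≡u[m] p pm)
    where
    1≤m = ≤-trans (s≤s z≤n) (≤′⇒≤ k<m)
    u[k]≡u[m] : at u k ≡ at u m
    u[k]≡u[m] = ≤-antisym (subst (_≤ at u m) (sym eq) (descending-at m (suc m) du 1≤m (n≤1+n m)))
                          (descending-at k m du 1≤k (≤-trans (n≤1+n k) (≤′⇒≤ k<m)))
    u[m]≡u[m+1] : at u m ≡ at u (suc m)
    u[m]≡u[m+1] = trans (sym u[k]≡u[m]) eq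

module SinkUniqueness {N la} (d : Descending la) {u u' τ τ'}
  (du : Descending u) (du' : Descending u') (rst : IsRST N la τ) (rst' : IsRST N la τ')
  (sink : IsSink N u τ) (sink' : IsSink N u' τ') (T≡ : map (map (at u)) τ ≡ map (map (at u')) τ') where

  open RSTOrder {N} d using (equal-values-precede)

  same-shape : map length τ ≡ map length τ'
  same-shape = trans (IsRST.shape rst) (sym (IsRST.shape rst'))

  T-cell : ∀ {c r k k'} → At τ c r k → At τ' c r k' → at u k ≡ at u' k'
  T-cell {c} {r} {k} p q =
    At-functional (subst (λ t → At t c r (at u k)) T≡ (At-map (at u) p)) (At-map (at u') q)

  SameCell : ℕ → Set
  SameCell k = ∀ {c r} → At τ c r k → At τ' c r k

  module _ {k} (below : ∀ {j} → j < k → SameCell j) where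

    -- as smaller labels occupy the same cells in τ and τ', a cell holding k
    -- in one of them holds a label ≥ k in the other
    τ'-label-≥ : ∀ {c r k''} → At τ c r k → At τ' c r k'' → k ≤ k''
    τ'-label-≥ {k'' = k''} p q with k'' <? k
    ... | no k''≮k = ≮⇒≥ k''≮k
    ... | yes k''<k with IsRST.onto rst (proj₁ (IsRST.range rst' q)) (proj₂ (IsRST.range rst' q))
    ...   | _ , _ , pz with IsRST.injective rst' (below k''<k pz) q
    ...     | refl , refl = ⊥-elim (<⇒≢ k''<k (At-functional pz p))

    τ-label-≥ : ∀ {c r m} → At τ' c r k → At τ c r m → k ≤ m
    τ-label-≥ {m = m} p' q' with m <? k
    ... | no m≮k  = ≮⇒≥ m≮k
    ... | yes m<k = ⊥-elim (<⇒≢ m<k (At-functional (below m<k q') p'))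

    -- k sits in cell (c,r) of τ and (c',r') of τ', which carry k'' in τ'
    -- and m in τ; if the cells differ, each filling reads its pair of labels
    -- in an order contradicting the other
    same-cell-step : SameCell k
    same-cell-step {c} {r} p with IsRST.onto rst' (proj₁ (IsRST.range rst p)) (proj₂ (IsRST.range rst p))
    ... | c' , r' , p' with At-exists-same-shape same-shape p | At-exists-same-shape (sym same-shape) p'
    ... | k'' , q | m , q' with (c ≟ c') ×-dec (r ≟ r')
    ...   | yes (refl , refl) = p'
    ...   | no cells≢ = ⊥-elim (Precedes-asym
              (equal-values-precede rst du sink 1≤k (≤⇒≤′ k<m) m≤N u[k]≡u[m] p q')
              (equal-values-precede rst' du' sink' 1≤k (≤⇒≤′ k<k'') k''≤N u'[k]≡u'[k''] p' q))
      where
      1≤k = proj₁ (IsRST.range rst p)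
      m≤N = proj₂ (IsRST.range rst q')
      k''≤N = proj₂ (IsRST.range rst' q)
      k≤k'' = τ'-label-≥ p q
      k≤m = τ-label-≥ p' q'
      k<m = ≤∧≢⇒< k≤m λ { refl → cells≢ (IsRST.injective rst p q') }
      k<k'' = ≤∧≢⇒< k≤k'' λ { refl → cells≢ (IsRST.injective rst' q p') }
      u[k]≡u[m] : at u k ≡ at u m
      u[k]≡u[m] = ≤-antisym (begin
        at u k      ≡⟨ T-cell p q ⟩
        at u' k''   ≤⟨ descending-at k k'' du' 1≤k k≤k'' ⟩
        at u' k     ≡⟨ T-cell q' p' ⟨
        at u m      ∎) (descending-at k m du 1≤k k≤m)
        where open ≤-Reasoning
      u'[k]≡u'[k''] : at u' k ≡ at u' k''
      u'[k]≡u'[k''] = trans (sym (T-cell q' p')) (trans (sym u[k]≡u[m]) (T-cell p q))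

  same-cell : ∀ k → SameCell k
  same-cell = <-rec SameCell (λ k below → same-cell-step below)

  τ≡τ' : τ ≡ τ'
  τ≡τ' = filling-ext τ τ' same-shape (λ p → same-cell _ p)

  u≡u' : length u ≡ N → length u' ≡ N → u ≡ u'
  u≡u' |u|≡N |u'|≡N = list-ext u u' (trans |u|≡N (sym |u'|≡N)) same-value
    where
    same-value : ∀ k → 1 ≤ k → k ≤ length u → at u k ≡ at u' k
    same-value k 1≤k k≤|u| with IsRST.onto rst 1≤k (subst (k ≤_) |u|≡N k≤|u|)
    ... | _ , _ , p = T-cell p (same-cell k p)

record SinkComponent (N : ℕ) (la : List ℕ) (x : Vertex) : Set where
  field
    τ*        : Filling
    u         : List ℕ
    desc      : Descending u
    length-u  : length u ≡ N
    rst       : IsRST N la τ*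
    sink      : IsSink N u τ*
    component : SameComponent N la x (τ* , u)

  Tfill-sink : Tfill (τ* , u) ≡ map (map (at u)) τ*
  Tfill-sink = cong (λ w → map (map (at w)) τ*) (vplus-id desc)

sink-component : ∀ {N la x} → IsPartition N la → IsVertex N la x → SinkComponent N la x
sink-component {N} {la} {τ , v} ip@(_ , _ , sum≡N) vx with vertex-invariant ip vx
... | rst , |v|≡N = record
  { τ* = SinkFrom.τ* target ; u = vplus v ; desc = vplus-descending v ; length-u = |v⁺|≡N
  ; rst = SinkFrom.rst target ; sink = SinkFrom.sink target
  ; component = proj₁ (SEdge-path-component vx (sort-SEdges τ (sort-path v) ◅◅ SinkFrom.path target)) }
  where
  |v⁺|≡N = trans (length-vplus v) |v|≡N
  open Sinks N la sum≡N (vplus v) (vplus-descending v) |v⁺|≡N using (SinkFrom; reach-sink)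
  target = reach-sink rst

proposition5p2 : (N : ℕ) (la : List ℕ) → IsPartition N la →
    (x y : Vertex) → IsVertex N la x → IsVertex N la y →
    (SameComponent N la x y → Tfill x ≡ Tfill y) × (Tfill x ≡ Tfill y → SameComponent N la x y)
proposition5p2 N la ip x y vx vy = Tfill-component , same-T⇒component
  where
  module X = SinkComponent (sink-component ip vx)
  module Y = SinkComponent (sink-component ip vy)
  same-T⇒component : Tfill x ≡ Tfill y → SameComponent N la x y
  same-T⇒component T≡ = X.component ◅◅ subst (λ z → SameComponent N la z y) (sym sinks≡) (symmetric _ Y.component)
    where
    sink-T≡ : map (map (at X.u)) X.τ* ≡ map (map (at Y.u)) Y.τ*
    sink-T≡ = begin
      map (map (at X.u)) X.τ*  ≡⟨ X.Tfill-sink ⟨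
      Tfill (X.τ* , X.u)       ≡⟨ Tfill-component X.component ⟨
      Tfill x                  ≡⟨ T≡ ⟩
      Tfill y                  ≡⟨ Tfill-component Y.component ⟩
      Tfill (Y.τ* , Y.u)       ≡⟨ Y.Tfill-sink ⟩
      map (map (at Y.u)) Y.τ*  ∎
      where open ≡-Reasoning
    sinks≡ : (X.τ* , X.u) ≡ (Y.τ* , Y.u)
    sinks≡ = cong₂ _,_ U.τ≡τ' (U.u≡u' X.length-u Y.length-u)
      where module U = SinkUniqueness (partition-descending ip) X.desc Y.desc X.rst Y.rst X.sink Y.sink sink-T≡
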